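{- For every arc $\alpha\in\mathcal A_n$, the union $\mathcal W(\mathrm{SP}(\alpha))$ of the walls of the normal fan of the shard polytope $\mathrm{SP}(\alpha)$ contains the shard $S(\alpha)$ and is contained in the union of the shards $S(\alpha')$ over all arcs $\alpha'$ forcing $\alpha$.
   Context: $]a,b[=\{a+1,\dots,b-1\}$, $(\mathbf e_i)$ the standard basis of $\mathbb R^n$, $\mathbb H=\{\mathbf x\in\mathbb R^n:\sum_i x_i=0\}$. An arc is a quadruple $\alpha=(a,b,A,B)$ with $1\le a<b\le n$ and $A\sqcup B=]a,b[$; $\mathcal A_n$ is the set of arcs. An $\alpha$-alternating matching is a (possibly empty) set $M=\{a_1<b_1<\dots<a_k<b_k\}$ with $a\le a_1$, $b_k\le b$, $a_i\in\{a\}\cup A$, $b_i\in B\cup\{b\}$; $\chi(M)=\sum_i(\mathbf e_{a_i}-\mathbf e_{b_i})$; the shard polytope is $\mathrm{SP}(\alpha)=\mathrm{conv}\{\chi(M)\}$ over all $\alpha$-alternating matchings. An arc $(a',b',A',B')$ forces... precisely: $\alpha'=(a',b',A',B')$ forces $\alpha=(a,b,A,B)$ if $a\le a'<b'\le b$, $A'\subseteq A$ and $B'\subseteq B$ (every arc forces itself). The shard of $\alpha$ is $S(\alpha)=\{\mathbf x\in\mathbb H: x_a=x_b,\ x_a\ge x_{a'}\ \forall a'\in A,\ x_a\le x_{b'}\ \forall b'\in B\}$. For a polytope $P\subset\mathbb H$, the union of the walls of its normal fan (within $\mathbb H$) is $\mathcal W(P)=\{\mathbf t\in\mathbb H:$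 the set of maximizers of $\mathbf x\mapsto\langle\mathbf t,\mathbf x\rangle$ on $P$ has more than one point$\}$. -}

module Defs where

open import Level using (0ℓ)
open import Data.Nat using (ℕ; zero; suc)
open import Data.Bool using (Bool; true; false; if_then_else_)
open import Data.Fin using (Fin; zero; suc) renaming (_<_ to _<ᶠ_; _≤_ to _≤ᶠ_)
open import Data.Fin.Properties using () renaming (_≟_ to _≟ᶠ_)
open import Data.Fin.Subset using (Subset; _∈_; _⊆_)
open import Data.List using (List; []; _∷_)
open import Data.List.Relation.Unary.All using (All)
open import Data.Maybe using (Maybe; just; nothing)
open import Data.Product using (Σ; ∃; ∃-syntax; _×_; _,_)
open import Data.Sum using (_⊎_)
open import Data.Unit using (⊤)
open import Relation.Nullary using (¬_; yes; no)
open import Relation.Binary.PropositionalEquality using (_≡_)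
open import Relation.Binary.Structures using (IsTotalOrder)
open import Algebra.Structures using (IsCommutativeRing)
open import Function.Bundles using (_⇔_)

-- Ordered fields (the paper works over ℝ, which is an ordered field;
-- the agda-stdlib has no real numbers, so we state the result for an
-- arbitrary ordered field, with ℝ as the intended instance).

record OrderedField : Set₁ where
  infixl 6 _+_
  infixl 7 _*_
  infix 4 _≤_
  field
    Carrier : Set
    _+_ _*_ : Carrier → Carrier → Carrier
    -_ : Carrier → Carrier
    0# 1# : Carrier
    isCommutativeRing : IsCommutativeRing _≡_ _+_ _*_ -_ 0# 1#
    _≤_ : Carrier → Carrier → Set
    isTotalOrder : IsTotalOrder _≡_ _≤_
    +-monoˡ-≤ : ∀ {x y} z → x ≤ y → x + z ≤ y + z
    *-nonneg : ∀ {x y} → 0# ≤ x → 0# ≤ y → 0# ≤ x * y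
    0≢1 : ¬ (0# ≡ 1#)
    inverse : ∀ x → ¬ (x ≡ 0#) → ∃ λ y → x * y ≡ 1#

-- Arcs on [n] (positions 1..n are encoded as Fin n, i.e. 0..n-1).
-- An arc (a,b,A,B): a < b, A and B disjoint with A ∪ B = ]a,b[.

record Arc (n : ℕ) : Set where
  field
    a b : Fin n
    a<b : a <ᶠ b
    A B : Subset n
    A∪B : ∀ i → (i ∈ A ⊎ i ∈ B) ⇔ (a <ᶠ i × i <ᶠ b)
    A∩B : ∀ i → ¬ (i ∈ A × i ∈ B)

Forces : ∀ {n} → Arc n → Arc n → Set
Forces α' α = (Arc.a α ≤ᶠ Arc.a α') × (Arc.b α' ≤ᶠ Arc.b α)
            × (Arc.A α' ⊆ Arc.A α) × (Arc.B α' ⊆ Arc.B α)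

-- strictly increasing a₁ < b₁ < a₂ < b₂ < … (the argument is the
-- previous right endpoint, if any)
Chain : ∀ {n} → Maybe (Fin n) → List (Fin n × Fin n) → Set
Chain p [] = ⊤
Chain nothing  ((x , y) ∷ r) = x <ᶠ y × Chain (just y) r
Chain (just p) ((x , y) ∷ r) = p <ᶠ x × x <ᶠ y × Chain (just y) r

IsAltMatching : ∀ {n} → Arc n → List (Fin n × Fin n) → Set
IsAltMatching α M =
  Chain nothing M ×
  All (λ { (x , y) → (x ≡ Arc.a α ⊎ x ∈ Arc.A α) × (y ∈ Arc.B α ⊎ y ≡ Arc.b α) }) M

module _ (F : OrderedField) where
  open OrderedField F

  Vect : ℕ → Set
  Vect n = Fin n → Carrier

  sumF : ∀ {n} → (Fin n → Carrier) → Carrier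
  sumF {zero} f = 0#
  sumF {suc n} f = f zero + sumF (λ i → f (suc i))

  basis : ∀ {n} → Fin n → Vect n
  basis i j with i ≟ᶠ j
  ... | yes _ = 1#
  ... | no _ = 0#

  inner : ∀ {n} → Vect n → Vect n → Carrier
  inner t x = sumF (λ j → t j * x j)

  InH : ∀ {n} → Vect n → Set
  InH t = sumF t ≡ 0#

  χ : ∀ {n} → List (Fin n × Fin n) → Vect n
  χ [] j = 0#
  χ ((x , y) ∷ r) j = (basis x j + - basis y j) + χ r j


  combo : ∀ {n} → List (List (Fin n × Fin n) × Carrier) → Vect n
  combo [] j = 0#
  combo ((M , l) ∷ r) j = l * χ M j + combo r j

  InSP : ∀ {n} → Arc n → Vect n → Set
  InSP {n} α x =
    ∃[ L ] (All (λ { (M , l) → IsAltMatching α M × 0# ≤ l }) L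
           × weights L ≡ 1#
           × (∀ j → x j ≡ combo L j))
    where
    weights : List (List (Fin n × Fin n) × Carrier) → Carrier
    weights [] = 0#
    weights ((_ , l) ∷ r) = l + weights r

  IsMaximizer : ∀ {n} → Arc n → Vect n → Vect n → Set
  IsMaximizer α t x = InSP α x × (∀ y → InSP α y → inner t y ≤ inner t x)

  -- t ∈ 𝒲(SP(α)): the face maximizing t has more than one point
  InWalls : ∀ {n} → Arc n → Vect n → Set
  InWalls α t = InH t × ∃[ x ] ∃[ y ]
    (IsMaximizer α t x × IsMaximizer α t y × ¬ (∀ j → x j ≡ y j))

  InShard : ∀ {n} → Arc n → Vect n → Set
  InShard α t = InH t × t (Arc.a α) ≡ t (Arc.b α)
    × (∀ a' → a' ∈ Arc.A α → t a' ≤ t (Arc.a α))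
    × (∀ b' → b' ∈ Arc.B α → t (Arc.a α) ≤ t b')

module Submission where

-- If t lies on S(α), every alternating matching M has ⟨t, χ(M)⟩ ≤ 0 since t is at most t_a on
-- {a} ∪ A and at least t_a = t_b on B ∪ {b}; both ∅ and {(a, b)} reach 0, so the face of SP(α)
-- maximizing t has two points.
--
-- Conversely fix an optimal alternating matching W. Comparing W with any other alternating
-- matching M at their first disagreement yields a sub-arc β of α (which forces α) and a slack
-- 0 ≤ s ≤ ⟨t, χ(W)⟩ − ⟨t, χ(M)⟩ such that s = 0 puts t on S(β); every inequality needed is
-- obtained by a local move on W (dropping, inserting, splitting or merging pairs, moving an
-- endpoint) that cannot increase its value. If x ≠ y both maximize t, every matching with positive
-- weight in their convex decompositions is optimal, so the least slack s occurring there satisfies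
-- s (x − y) = 0, whence s = 0.

open import Defs

open import Algebra.Bundles using (CommutativeRing)
open import Algebra.Structures using (IsCommutativeRing)
import Algebra.Solver.Ring.AlmostCommutativeRing as ACR
open import Data.Bool.Properties using (T-≡)
open import Data.Empty using (⊥-elim)
open import Data.Fin using (Fin; zero; suc; toℕ) renaming (_<_ to _<ᶠ_; _≤_ to _≤ᶠ_)
import Data.Fin.Properties as Fin
open import Data.Fin.Subset using (Subset; _∈_; _∩_)
open import Data.Fin.Subset.Properties using (x∈p∩q⁺; x∈p∩q⁻; _∈?_)
open import Data.Integer as ℤ using (ℤ; -[1+_]; _⊖_)
import Data.Integer.Properties as ℤ
open import Data.List as List using (List; []; _∷_; _++_; length; allFin; cartesianProduct; concatMap; filter)
import Data.List.Extrema
open import Data.List.Membership.Propositional using () renaming (_∈_ to _∈ₗ_)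
open import Data.List.Membership.Propositional.Properties
  using (∈-allFin; ∈-cartesianProduct⁺; ∈-concatMap⁺; ∈-map⁺; ∈-filter⁺)
import Data.List.Properties as List
open import Data.List.Relation.Unary.All as All using (All; []; _∷_)
import Data.List.Relation.Unary.All.Properties as All
open import Data.List.Relation.Unary.Any as Any using (here; there)
open import Data.Maybe using (Maybe; just; nothing)
open import Data.Nat as ℕ using (ℕ; zero; suc)
import Data.Nat.Properties as ℕ
open import Data.Product using (_×_; ∃-syntax; Σ; _,_; proj₁; proj₂; uncurry)
import Data.Product.Properties as Product
open import Data.Sum as Sum using (_⊎_; inj₁; inj₂)
open import Data.Unit using (⊤; tt)
open import Data.Vec using (tabulate)
open import Data.Vec.Properties using (lookup∘tabulate; []=⇒lookup; lookup⇒[]=)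
open import Function using (_∘_)
open import Function.Bundles using (Equivalence; mk⇔)
open import Relation.Binary.Bundles using (TotalOrder)
open import Relation.Binary.Definitions using (tri<; tri≈; tri>)
open import Relation.Binary.PropositionalEquality
open import Relation.Binary.Structures using (IsTotalOrder)
open import Relation.Nullary using (¬_; Dec; yes; no)
open import Relation.Nullary.Decidable using (_×-dec_; _⊎-dec_; map′; isYes; toWitness; fromWitness; dec⇒maybe)

module OrderedFieldProperties (F : OrderedField) where
  open OrderedField F public
  open IsCommutativeRing isCommutativeRing public
    using (+-comm; +-identityˡ; +-identityʳ; -‿inverseʳ; *-assoc; *-comm;
           *-identityˡ; *-identityʳ; distribˡ; zeroˡ; zeroʳ)
  open IsTotalOrder isTotalOrder public
    using (total; antisym) renaming (refl to ≤-refl; trans to ≤-trans; reflexive to ≤-reflexive)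

  ≤-totalOrder : TotalOrder _ _ _
  ≤-totalOrder = record { isTotalOrder = isTotalOrder }

  commutativeRing : CommutativeRing _ _
  commutativeRing = record { isCommutativeRing = isCommutativeRing }

  open CommutativeRing commutativeRing using (semiring; ring; +-group; +-abelianGroup; +-commutativeSemigroup)
  open import Algebra.Properties.Semiring.Mult.TCOptimised semiring using (1+×; ×-homo-+; ×1-homo-*) renaming (_×_ to _×ₙ_)
  open import Algebra.Properties.Ring ring public using (-‿distribˡ-*; -‿distribʳ-*)
  open import Algebra.Properties.Group +-group public using ()
    renaming (x∙y⁻¹≈ε⇒x≈y to x-y≡0⇒x≡y; x≈y⇒x∙y⁻¹≈ε to x≡y⇒x-y≡0)
  open import Algebra.Properties.Group +-group using (ε⁻¹≈ε; ⁻¹-involutive)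
  open import Algebra.Properties.AbelianGroup +-abelianGroup using (⁻¹-∙-comm)
  open import Algebra.Properties.CommutativeSemigroup +-commutativeSemigroup using (interchange)
  open ≡-Reasoning

  infixl 6 _-_
  _-_ : Carrier → Carrier → Carrier
  x - y = x + - y

  ⟦_⟧ℤ : ℤ → Carrier
  ⟦ ℤ.+ n ⟧ℤ = n ×ₙ 1#
  ⟦ -[1+ n ] ⟧ℤ = - (suc n ×ₙ 1#)

  ⊖-homo : ∀ m n → ⟦ m ⊖ n ⟧ℤ ≡ m ×ₙ 1# - n ×ₙ 1#
  ⊖-homo m zero = sym (trans (cong ((m ×ₙ 1#) +_) ε⁻¹≈ε) (+-identityʳ _))
  ⊖-homo zero (suc n) = sym (+-identityˡ _)
  ⊖-homo (suc m) (suc n) = begin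
    ⟦ suc m ⊖ suc n ⟧ℤ                  ≡⟨ cong ⟦_⟧ℤ (ℤ.[1+m]⊖[1+n]≡m⊖n m n) ⟩
    ⟦ m ⊖ n ⟧ℤ                          ≡⟨ ⊖-homo m n ⟩
    m ×ₙ 1# - n ×ₙ 1#                     ≡⟨ +-identityˡ _ ⟨
    0# + (m ×ₙ 1# - n ×ₙ 1#)              ≡⟨ cong (_+ (m ×ₙ 1# - n ×ₙ 1#)) (-‿inverseʳ 1#) ⟨
    (1# - 1#) + (m ×ₙ 1# - n ×ₙ 1#)       ≡⟨ interchange 1# (- 1#) (m ×ₙ 1#) (- (n ×ₙ 1#)) ⟩
    (1# + m ×ₙ 1#) + (- 1# + - (n ×ₙ 1#)) ≡⟨ cong ((1# + m ×ₙ 1#) +_) (⁻¹-∙-comm 1# (n ×ₙ 1#)) ⟩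
    (1# + m ×ₙ 1#) - (1# + n ×ₙ 1#)       ≡⟨ cong₂ _-_ (1+× m 1#) (1+× n 1#) ⟨
    suc m ×ₙ 1# - suc n ×ₙ 1#             ∎

  -‿homo : ∀ i → ⟦ ℤ.- i ⟧ℤ ≡ - ⟦ i ⟧ℤ
  -‿homo (ℤ.+ zero) = sym ε⁻¹≈ε
  -‿homo (ℤ.+ suc n) = refl
  -‿homo -[1+ n ] = sym (⁻¹-involutive _)

  +-homo : ∀ i j → ⟦ i ℤ.+ j ⟧ℤ ≡ ⟦ i ⟧ℤ + ⟦ j ⟧ℤ
  +-homo (ℤ.+ m) (ℤ.+ n) = ×-homo-+ 1# m n
  +-homo (ℤ.+ m) -[1+ n ] = ⊖-homo m (suc n)
  +-homo -[1+ m ] (ℤ.+ n) = trans (⊖-homo n (suc m)) (+-comm _ _)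
  +-homo -[1+ m ] -[1+ n ] = begin
    - (suc (suc (m ℕ.+ n)) ×ₙ 1#)      ≡⟨ cong (λ k → - (suc k ×ₙ 1#)) (ℕ.+-suc m n) ⟨
    - ((suc m ℕ.+ suc n) ×ₙ 1#)        ≡⟨ cong -_ (×-homo-+ 1# (suc m) (suc n)) ⟩
    - (suc m ×ₙ 1# + suc n ×ₙ 1#)       ≡⟨ ⁻¹-∙-comm _ _ ⟨
    - (suc m ×ₙ 1#) + - (suc n ×ₙ 1#)   ∎

  +*-homo : ∀ m j → ⟦ ℤ.+ m ℤ.* j ⟧ℤ ≡ ⟦ ℤ.+ m ⟧ℤ * ⟦ j ⟧ℤ
  +*-homo m (ℤ.+ n) = trans (cong ⟦_⟧ℤ (sym (ℤ.pos-* m n))) (×1-homo-* m n)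
  +*-homo m -[1+ n ] = begin
    ⟦ ℤ.+ m ℤ.* ℤ.- ℤ.+ suc n ⟧ℤ        ≡⟨ cong ⟦_⟧ℤ (ℤ.neg-distribʳ-* (ℤ.+ m) (ℤ.+ suc n)) ⟨
    ⟦ ℤ.- (ℤ.+ m ℤ.* ℤ.+ suc n) ⟧ℤ      ≡⟨ -‿homo (ℤ.+ m ℤ.* ℤ.+ suc n) ⟩
    - ⟦ ℤ.+ m ℤ.* ℤ.+ suc n ⟧ℤ          ≡⟨ cong -_ (+*-homo m (ℤ.+ suc n)) ⟩
    - (⟦ ℤ.+ m ⟧ℤ * ⟦ ℤ.+ suc n ⟧ℤ)     ≡⟨ -‿distribʳ-* _ _ ⟩
    ⟦ ℤ.+ m ⟧ℤ * ⟦ -[1+ n ] ⟧ℤ        ∎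

  *-homo : ∀ i j → ⟦ i ℤ.* j ⟧ℤ ≡ ⟦ i ⟧ℤ * ⟦ j ⟧ℤ
  *-homo (ℤ.+ m) j = +*-homo m j
  *-homo -[1+ m ] j = begin
    ⟦ ℤ.- ℤ.+ suc m ℤ.* j ⟧ℤ       ≡⟨ cong ⟦_⟧ℤ (ℤ.neg-distribˡ-* (ℤ.+ suc m) j) ⟨
    ⟦ ℤ.- (ℤ.+ suc m ℤ.* j) ⟧ℤ     ≡⟨ -‿homo (ℤ.+ suc m ℤ.* j) ⟩
    - ⟦ ℤ.+ suc m ℤ.* j ⟧ℤ         ≡⟨ cong -_ (+*-homo (suc m) j) ⟩
    - (⟦ ℤ.+ suc m ⟧ℤ * ⟦ j ⟧ℤ)    ≡⟨ -‿distribˡ-* _ _ ⟩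
    ⟦ -[1+ m ] ⟧ℤ * ⟦ j ⟧ℤ       ∎

  morphism : ℤ.+-*-rawRing ACR.-Raw-AlmostCommutative⟶ ACR.fromCommutativeRing commutativeRing
  morphism = record
    { ⟦_⟧ = ⟦_⟧ℤ ; +-homo = +-homo ; *-homo = *-homo ; -‿homo = -‿homo
    ; 0-homo = refl ; 1-homo = refl }

  -- The ring solver normalises polynomials with integer coefficients, read in F through ⟦_⟧ℤ.
  coefficient-≟ : ∀ i j → Maybe (⟦ i ⟧ℤ ≡ ⟦ j ⟧ℤ)
  coefficient-≟ i j = Data.Maybe.map (cong ⟦_⟧ℤ) (dec⇒maybe (i ℤ.≟ j))

  open import Algebra.Solver.Ring ℤ.+-*-rawRing (ACR.fromCommutativeRing commutativeRing) morphism coefficient-≟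
    public

  :0 : ∀ {k} → Polynomial k
  :0 = con (ℤ.+ 0)

  ≤-transfer : ∀ {x y u v} → x ≤ y → y - x ≡ v - u → u ≤ v
  ≤-transfer {x} {u = u} {v} x≤y eq = subst₂ _≤_ (+-identityˡ u) v-u+u≡v (+-monoˡ-≤ u 0≤v-u)
    where
    0≤v-u : 0# ≤ v - u
    0≤v-u = subst₂ _≤_ (-‿inverseʳ x) eq (+-monoˡ-≤ (- x) x≤y)
    v-u+u≡v : v - u + u ≡ v
    v-u+u≡v = solve 2 (λ u v → v :- u :+ u := v) refl u v

  x≤y⇒x-y≤0 : ∀ {x y} → x ≤ y → x - y ≤ 0#
  x≤y⇒x-y≤0 {x} {y} x≤y = ≤-transfer x≤y (solve 2 (λ x y → y :- x := :0 :- (x :- y)) refl x y)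

  x≤y⇒0≤y-x : ∀ {x y} → x ≤ y → 0# ≤ y - x
  x≤y⇒0≤y-x {x} x≤y = subst (_≤ _) (-‿inverseʳ x) (+-monoˡ-≤ (- x) x≤y)

  +-mono-≤ : ∀ {x y u v} → x ≤ y → u ≤ v → x + u ≤ y + v
  +-mono-≤ {y = y} {u} {v} x≤y u≤v =
    ≤-trans (+-monoˡ-≤ u x≤y) (subst₂ _≤_ (+-comm u y) (+-comm v y) (+-monoˡ-≤ y u≤v))

  *-monoˡ-≤-nonNeg : ∀ {x y} z → 0# ≤ z → x ≤ y → x * z ≤ y * z
  *-monoˡ-≤-nonNeg {x} {y} z 0≤z x≤y = ≤-transfer (*-nonneg (x≤y⇒0≤y-x x≤y) 0≤z)
    (solve 3 (λ x y z → (y :- x) :* z :- :0 := y :* z :- x :* z) refl x y z)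

  0≤x*x : ∀ x → 0# ≤ x * x
  0≤x*x x with total 0# x
  ... | inj₁ 0≤x = *-nonneg 0≤x 0≤x
  ... | inj₂ x≤0 = subst (0# ≤_) (solve 1 (λ x → (:- x) :* (:- x) := x :* x) refl x) (*-nonneg 0≤-x 0≤-x)
    where
    0≤-x : 0# ≤ - x
    0≤-x = subst₂ _≤_ (-‿inverseʳ x) (+-identityˡ (- x)) (+-monoˡ-≤ (- x) x≤0)

  0≤1 : 0# ≤ 1#
  0≤1 = subst (0# ≤_) (*-identityʳ 1#) (0≤x*x 1#)

  x+y≤0⇒x≡0 : ∀ {x y} → 0# ≤ x → 0# ≤ y → x + y ≤ 0# → x ≡ 0#
  x+y≤0⇒x≡0 {x} 0≤x 0≤y x+y≤0 =
    antisym (≤-trans (subst₂ _≤_ (+-identityʳ x) refl (+-mono-≤ ≤-refl 0≤y)) x+y≤0) 0≤x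

  x+y≤0⇒y≡0 : ∀ {x y} → 0# ≤ x → 0# ≤ y → x + y ≤ 0# → y ≡ 0#
  x+y≤0⇒y≡0 {x} {y} 0≤x 0≤y x+y≤0 = x+y≤0⇒x≡0 0≤y 0≤x (subst (_≤ 0#) (+-comm x y) x+y≤0)

  *≡0-antimono : ∀ {l c g} → 0# ≤ l → 0# ≤ c → c ≤ g → l * g ≡ 0# → l * c ≡ 0#
  *≡0-antimono {l} {c} {g} 0≤l 0≤c c≤g l*g≡0 = antisym
    (subst₂ _≤_ (*-comm c l) (trans (*-comm g l) l*g≡0) (*-monoˡ-≤-nonNeg l 0≤l c≤g))
    (subst (0# ≤_) (*-comm c l) (*-nonneg 0≤c 0≤l))

  x*x≡0⇒¬¬x≡0 : ∀ x → x * x ≡ 0# → ¬ ¬ (x ≡ 0#)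
  x*x≡0⇒¬¬x≡0 x x*x≡0 x≢0 with inverse x x≢0
  ... | y , x*y≡1 = x≢0 (begin
    x            ≡⟨ *-identityʳ x ⟨
    x * 1#       ≡⟨ cong (x *_) x*y≡1 ⟨
    x * (x * y)  ≡⟨ *-assoc x x y ⟨
    x * x * y    ≡⟨ cong (_* y) x*x≡0 ⟩
    0# * y       ≡⟨ zeroˡ y ⟩
    0#           ∎)

module LinearAlgebra (F : OrderedField) where
  open OrderedFieldProperties F
  open ≡-Reasoning

  sumF-cong : ∀ {n} {f g : Fin n → Carrier} → (∀ j → f j ≡ g j) → sumF F f ≡ sumF F g
  sumF-cong {zero} f≗g = refl
  sumF-cong {suc n} f≗g = cong₂ _+_ (f≗g zero) (sumF-cong (λ j → f≗g (suc j)))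

  sumF-0 : ∀ {n} → sumF F {n} (λ _ → 0#) ≡ 0#
  sumF-0 {zero} = refl
  sumF-0 {suc n} = trans (cong (0# +_) (sumF-0 {n})) (+-identityˡ 0#)

  sumF-+ : ∀ {n} (f g : Fin n → Carrier) → sumF F (λ j → f j + g j) ≡ sumF F f + sumF F g
  sumF-+ {zero} f g = sym (+-identityˡ 0#)
  sumF-+ {suc n} f g = trans (cong ((f zero + g zero) +_) (sumF-+ (λ j → f (suc j)) (λ j → g (suc j))))
    (solve 4 (λ a b c d → (a :+ b) :+ (c :+ d) := (a :+ c) :+ (b :+ d)) refl _ _ _ _)

  sumF-* : ∀ {n} c (f : Fin n → Carrier) → sumF F (λ j → c * f j) ≡ c * sumF F f
  sumF-* {zero} c f = sym (zeroʳ c)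
  sumF-* {suc n} c f = trans (cong (c * f zero +_) (sumF-* c (λ j → f (suc j)))) (sym (distribˡ c _ _))

  sumF-neg : ∀ {n} (f : Fin n → Carrier) → sumF F (λ j → - f j) ≡ - sumF F f
  sumF-neg {zero} f = solve 0 (:0 := :- :0) refl
  sumF-neg {suc n} f = trans (cong (- f zero +_) (sumF-neg (λ j → f (suc j))))
    (solve 2 (λ x y → :- x :+ :- y := :- (x :+ y)) refl _ _)

  sumF-nonneg : ∀ {n} (f : Fin n → Carrier) → (∀ j → 0# ≤ f j) → 0# ≤ sumF F f
  sumF-nonneg {zero} f 0≤f = ≤-refl
  sumF-nonneg {suc n} f 0≤f = subst (_≤ sumF F f) (+-identityˡ 0#)
    (+-mono-≤ (0≤f zero) (sumF-nonneg (λ j → f (suc j)) (λ j → 0≤f (suc j))))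

  sumF≤0⇒≡0 : ∀ {n} (f : Fin n → Carrier) → (∀ j → 0# ≤ f j) → sumF F f ≤ 0# → ∀ j → f j ≡ 0#
  sumF≤0⇒≡0 {suc n} f 0≤f Σf≤0 zero =
    x+y≤0⇒x≡0 (0≤f zero) (sumF-nonneg (λ j → f (suc j)) (λ j → 0≤f (suc j))) Σf≤0
  sumF≤0⇒≡0 {suc n} f 0≤f Σf≤0 (suc j) = sumF≤0⇒≡0 (λ j → f (suc j)) (λ j → 0≤f (suc j))
    (≤-reflexive (x+y≤0⇒y≡0 (0≤f zero) (sumF-nonneg (λ j → f (suc j)) (λ j → 0≤f (suc j))) Σf≤0)) j

  basis-≡ : ∀ {n} {i j : Fin n} → i ≡ j → basis F i j ≡ 1#
  basis-≡ {i = i} {j} i≡j with i Fin.≟ j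
  ... | yes _ = refl
  ... | no i≢j = ⊥-elim (i≢j i≡j)

  basis-≢ : ∀ {n} {i j : Fin n} → ¬ (i ≡ j) → basis F i j ≡ 0#
  basis-≢ {i = i} {j} i≢j with i Fin.≟ j
  ... | yes i≡j = ⊥-elim (i≢j i≡j)
  ... | no _ = refl

  basis-suc : ∀ {n} (i j : Fin n) → basis F (suc i) (suc j) ≡ basis F i j
  basis-suc i j with i Fin.≟ j
  ... | yes _ = refl
  ... | no _ = refl

  inner-cong : ∀ {n} (t : Vect F n) {u v : Vect F n} → (∀ j → u j ≡ v j) → inner F t u ≡ inner F t v
  inner-cong t u≗v = sumF-cong (λ j → cong (t j *_) (u≗v j))

  inner-0 : ∀ {n} (t : Vect F n) → inner F t (λ _ → 0#) ≡ 0#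
  inner-0 {n} t = trans (sumF-cong (λ j → zeroʳ (t j))) (sumF-0 {n})

  inner-+ : ∀ {n} (t u v : Vect F n) → inner F t (λ j → u j + v j) ≡ inner F t u + inner F t v
  inner-+ t u v = trans (sumF-cong (λ j → distribˡ (t j) (u j) (v j))) (sumF-+ (λ j → t j * u j) (λ j → t j * v j))

  inner-- : ∀ {n} (t u : Vect F n) → inner F t (λ j → - u j) ≡ - inner F t u
  inner-- t u = trans (sumF-cong (λ j → sym (-‿distribʳ-* (t j) (u j)))) (sumF-neg (λ j → t j * u j))

  inner-* : ∀ {n} (t u : Vect F n) c → inner F t (λ j → c * u j) ≡ c * inner F t u
  inner-* t u c = trans (sumF-cong (λ j → solve 3 (λ x c u → x :* (c :* u) := c :* (x :* u)) refl (t j) c (u j)))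
    (sumF-* c (λ j → t j * u j))

  inner-basis : ∀ {n} (t : Vect F n) i → inner F t (basis F i) ≡ t i
  inner-basis {suc n} t zero = begin
    t zero * basis F {suc n} zero zero + sumF F (λ j → t (suc j) * basis F {suc n} zero (suc j))
      ≡⟨ cong₂ _+_ (cong (t zero *_) (basis-≡ {suc n} {zero} refl))
                   (sumF-cong (λ j → trans (cong (t (suc j) *_) (basis-≢ {suc n} {zero} {suc j} λ ())) (zeroʳ _))) ⟩
    t zero * 1# + sumF F {n} (λ _ → 0#)  ≡⟨ cong₂ _+_ (*-identityʳ _) (sumF-0 {n}) ⟩
    t zero + 0#                          ≡⟨ +-identityʳ _ ⟩
    t zero                               ∎
  inner-basis {suc n} t (suc i) = begin
    t zero * basis F (suc i) zero + sumF F (λ j → t (suc j) * basis F (suc i) (suc j))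
      ≡⟨ cong₂ _+_ (trans (cong (t zero *_) (basis-≢ {suc n} {suc i} {zero} λ ())) (zeroʳ _))
                   (sumF-cong (λ j → cong (t (suc j) *_) (basis-suc i j))) ⟩
    0# + inner F (λ j → t (suc j)) (basis F i) ≡⟨ +-identityˡ _ ⟩
    inner F (λ j → t (suc j)) (basis F i)      ≡⟨ inner-basis (λ j → t (suc j)) i ⟩
    t (suc i)                                  ∎

  ¬¬-∀-Fin : ∀ {n} {P : Fin n → Set} → (∀ j → ¬ ¬ P j) → ¬ ¬ (∀ j → P j)
  ¬¬-∀-Fin {zero} ¬¬P ¬∀P = ¬∀P λ ()
  ¬¬-∀-Fin {suc n} {P} ¬¬P ¬∀P = ¬¬P zero λ P0 →
    ¬¬-∀-Fin {n} {λ j → P (suc j)} (λ j → ¬¬P (suc j)) λ ∀Psuc → ¬∀P λ { zero → P0 ; (suc j) → ∀Psuc j }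

  -- The sum of the squares of the entries of v is nonzero, hence invertible.
  c*v≡0⇒c≡0 : ∀ {n} (v : Vect F n) → ¬ (∀ j → v j ≡ 0#) → ∀ c → (∀ j → c * v j ≡ 0#) → c ≡ 0#
  c*v≡0⇒c≡0 {n} v v≢0 c c*v≡0 = begin
    c               ≡⟨ *-identityʳ c ⟨
    c * 1#          ≡⟨ cong (c *_) s*s⁻¹≡1 ⟨
    c * (s * s⁻¹)   ≡⟨ *-assoc c s s⁻¹ ⟨
    (c * s) * s⁻¹   ≡⟨ cong (_* s⁻¹) c*s≡0 ⟩
    0# * s⁻¹        ≡⟨ zeroˡ s⁻¹ ⟩
    0#              ∎
    where
    s : Carrier
    s = sumF F (λ j → v j * v j)
    s≢0 : ¬ (s ≡ 0#)
    s≢0 s≡0 = ¬¬-∀-Fin (λ j → x*x≡0⇒¬¬x≡0 (v j)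
      (sumF≤0⇒≡0 (λ j → v j * v j) (λ j → 0≤x*x (v j)) (≤-reflexive s≡0) j)) v≢0
    s⁻¹ : Carrier
    s⁻¹ = proj₁ (inverse s s≢0)
    s*s⁻¹≡1 : s * s⁻¹ ≡ 1#
    s*s⁻¹≡1 = proj₂ (inverse s s≢0)
    c*s≡0 : c * s ≡ 0#
    c*s≡0 = begin
      c * s                                ≡⟨ sumF-* c (λ j → v j * v j) ⟨
      sumF F (λ j → c * (v j * v j))       ≡⟨ sumF-cong (λ j → trans (sym (*-assoc c (v j) (v j)))
                                                                  (trans (cong (_* v j) (c*v≡0 j)) (zeroˡ (v j)))) ⟩
      sumF F {n} (λ _ → 0#)                ≡⟨ sumF-0 {n} ⟩
      0#                                   ∎

module Matchings (F : OrderedField) {n : ℕ} (α : Arc n) (t : Vect F n) where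
  open OrderedFieldProperties F
  open LinearAlgebra F
  open Arc α

  Pair : Set
  Pair = Fin n × Fin n

  LeftEnd : Fin n → Set
  LeftEnd x = x ≡ a ⊎ x ∈ A

  RightEnd : Fin n → Set
  RightEnd y = y ∈ B ⊎ y ≡ b

  Edge : Pair → Set
  Edge (x , y) = LeftEnd x × RightEnd y

  After : Maybe (Fin n) → Fin n → Set
  After nothing _ = ⊤
  After (just p) x = p <ᶠ x

  record Alternating (bd : Maybe (Fin n)) (M : List Pair) : Set where
    constructor alternating
    field
      chain : Chain bd M
      edges : All Edge M

  value : List Pair → Carrier
  value [] = 0#
  value ((x , y) ∷ M) = t x - t y + value M

  record Optimal (bd : Maybe (Fin n)) (W : List Pair) : Set where
    constructor optimal
    field
      dominates : ∀ M → Alternating bd M → value M ≤ value W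

  open Optimal

  InRange : Fin n → Set
  InRange x = a ≤ᶠ x × x ≤ᶠ b

  interior : ∀ {x} → x ∈ A ⊎ x ∈ B → a <ᶠ x × x <ᶠ b
  interior {x} = Equivalence.to (A∪B x)

  left-inRange : ∀ {x} → LeftEnd x → InRange x
  left-inRange (inj₁ refl) = ℕ.≤-refl , ℕ.<⇒≤ a<b
  left-inRange (inj₂ x∈A) = ℕ.<⇒≤ (proj₁ (interior (inj₁ x∈A))) , ℕ.<⇒≤ (proj₂ (interior (inj₁ x∈A)))

  right-inRange : ∀ {y} → RightEnd y → InRange y
  right-inRange (inj₁ y∈B) = ℕ.<⇒≤ (proj₁ (interior (inj₂ y∈B))) , ℕ.<⇒≤ (proj₂ (interior (inj₂ y∈B)))
  right-inRange (inj₂ refl) = ℕ.<⇒≤ a<b , ℕ.≤-refl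

  left≢right : ∀ {x y} → LeftEnd x → RightEnd y → ¬ x ≡ y
  left≢right (inj₁ refl) (inj₁ a∈B) refl = ℕ.<-irrefl refl (proj₁ (interior (inj₂ a∈B)))
  left≢right (inj₁ refl) (inj₂ refl) a≡b = Fin.<-irrefl a≡b a<b
  left≢right (inj₂ x∈A) (inj₁ x∈B) refl = A∩B _ (x∈A , x∈B)
  left≢right (inj₂ b∈A) (inj₂ refl) refl = ℕ.<-irrefl refl (proj₂ (interior (inj₁ b∈A)))

  after-< : ∀ {bd x y} → After bd x → x <ᶠ y → After bd y
  after-< {nothing} _ _ = tt
  after-< {just _} p<x x<y = ℕ.<-trans p<x x<y

  alt-∷ : ∀ {bd x y M} → After bd x → x <ᶠ y → Edge (x , y) → Alternating (just y) M
        → Alternating bd ((x , y) ∷ M)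
  alt-∷ {nothing} _ x<y e (alternating c es) = alternating (x<y , c) (e ∷ es)
  alt-∷ {just _} p<x x<y e (alternating c es) = alternating (p<x , x<y , c) (e ∷ es)

  record Head (bd : Maybe (Fin n)) (x y : Fin n) (M : List Pair) : Set where
    field
      after : After bd x
      ordered : x <ᶠ y
      left : LeftEnd x
      right : RightEnd y
      rest : Alternating (just y) M

  alt-uncons : ∀ {bd x y M} → Alternating bd ((x , y) ∷ M) → Head bd x y M
  alt-uncons {nothing} (alternating (x<y , c) ((l , r) ∷ es)) = record
    { after = tt ; ordered = x<y ; left = l ; right = r ; rest = alternating c es }
  alt-uncons {just _} (alternating (p<x , x<y , c) ((l , r) ∷ es)) = record
    { after = p<x ; ordered = x<y ; left = l ; right = r ; rest = alternating c es }

  alt-rebase : ∀ {bd bd' x y M} → After bd' x → Alternating bd ((x , y) ∷ M) → Alternating bd' ((x , y) ∷ M)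
  alt-rebase after-x alt = alt-∷ after-x ordered (left , right) rest
    where open Head (alt-uncons alt)

  alt-after : ∀ {bd y M} → After bd y → Alternating (just y) M → Alternating bd M
  alt-after {M = []} _ _ = alternating tt []
  alt-after {M = (_ , _) ∷ _} after-y alt = alt-rebase (after-< after-y (Head.after (alt-uncons alt))) alt

  inner-χ : ∀ M → inner F t (χ F M) ≡ value M
  inner-χ [] = inner-0 t
  inner-χ ((x , y) ∷ M) = begin
    inner F t (λ j → (basis F x j - basis F y j) + χ F M j)
      ≡⟨ inner-+ t (λ j → basis F x j - basis F y j) (χ F M) ⟩
    inner F t (λ j → basis F x j - basis F y j) + inner F t (χ F M)
      ≡⟨ cong₂ _+_ (trans (inner-+ t (basis F x) (λ j → - basis F y j))
                          (cong₂ _+_ (inner-basis t x) (trans (inner-- t (basis F y)) (cong -_ (inner-basis t y)))))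
                   (inner-χ M) ⟩
    t x - t y + value M ∎
    where open ≡-Reasoning

  chain? : ∀ (bd : Maybe (Fin n)) M → Dec (Chain bd M)
  chain? bd [] = yes tt
  chain? nothing ((x , y) ∷ M) = (x Fin.<? y) ×-dec chain? (just y) M
  chain? (just p) ((x , y) ∷ M) = (p Fin.<? x) ×-dec ((x Fin.<? y) ×-dec chain? (just y) M)

  edge? : ∀ e → Dec (Edge e)
  edge? (x , y) = ((x Fin.≟ a) ⊎-dec (x ∈? A)) ×-dec ((y ∈? B) ⊎-dec (y Fin.≟ b))

  alternating? : ∀ M → Dec (Alternating nothing M)
  alternating? M = map′ (uncurry alternating) (λ h → Alternating.chain h , Alternating.edges h)
    (chain? nothing M ×-dec All.all? {P = Edge} edge? M)

  listsOfLength≤ : ℕ → List (List Pair)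
  listsOfLength≤ zero = [] ∷ []
  listsOfLength≤ (suc k) =
    [] ∷ concatMap (λ e → List.map (e ∷_) (listsOfLength≤ k)) (cartesianProduct (allFin n) (allFin n))

  ∈-listsOfLength≤ : ∀ k M → length M ℕ.≤ k → M ∈ₗ listsOfLength≤ k
  ∈-listsOfLength≤ zero [] _ = here refl
  ∈-listsOfLength≤ (suc k) [] _ = here refl
  ∈-listsOfLength≤ (suc k) ((x , y) ∷ M) (ℕ.s≤s |M|≤k) =
    there (∈-concatMap⁺ (λ e → List.map (e ∷_) (listsOfLength≤ k))
    (Any.map (λ { refl → ∈-map⁺ ((x , y) ∷_) (∈-listsOfLength≤ k M |M|≤k) })
             (∈-cartesianProduct⁺ (∈-allFin x) (∈-allFin y))))

  length-chain : ∀ {p} M → Chain (just p) M → toℕ p ℕ.+ length M ℕ.< n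
  length-chain {p} [] _ = subst (ℕ._< n) (sym (ℕ.+-identityʳ (toℕ p))) (Fin.toℕ<n p)
  length-chain {p} ((_ , y) ∷ M) (p<x , x<y , c) = begin-strict
    toℕ p ℕ.+ suc (length M)  ≡⟨ ℕ.+-suc (toℕ p) (length M) ⟩
    suc (toℕ p) ℕ.+ length M  ≤⟨ ℕ.+-monoˡ-≤ (length M) (ℕ.<-trans p<x x<y) ⟩
    toℕ y ℕ.+ length M        <⟨ length-chain M c ⟩
    n                         ∎
    where open ℕ.≤-Reasoning

  length-alternating : ∀ M → Chain nothing M → length M ℕ.≤ n
  length-alternating [] _ = ℕ.z≤n
  length-alternating ((_ , y) ∷ M) (_ , c) = ℕ.≤-trans (ℕ.s≤s (ℕ.m≤n+m (length M) (toℕ y))) (length-chain M c)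

  open Data.List.Extrema ≤-totalOrder using (argmax; argmax-all; f[xs]≤f[argmax])

  best : List Pair
  best = argmax value [] (filter alternating? (listsOfLength≤ n))

  best-alternating : Alternating nothing best
  best-alternating = argmax-all value (alternating tt []) (All.all-filter alternating? (listsOfLength≤ n))

  best-optimal : Optimal nothing best
  best-optimal = optimal λ M altM →
    All.lookup (f[xs]≤f[argmax] {f = value} [] (filter alternating? (listsOfLength≤ n)))
               (∈-filter⁺ alternating? (∈-listsOfLength≤ n M (length-alternating M (Alternating.chain altM))) altM)

  -- Each move turns W into another alternating matching, whose value cannot exceed that of W.
  module LocalMoves {bd w₁ w₂ W'} (opt : Optimal bd ((w₁ , w₂) ∷ W'))
                    (alt : Alternating bd ((w₁ , w₂) ∷ W')) where
    open Head (alt-uncons alt) public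
      renaming (after to after₁; ordered to w₁<w₂; left to left₁; right to right₂)

    drop-first-pair : t w₂ ≤ t w₁
    drop-first-pair = ≤-transfer (dominates opt W' (alt-after (after-< after₁ w₁<w₂) rest))
      (solve 3 (λ x y v → x :- y :+ v :- v := x :- y) refl (t w₁) (t w₂) (value W'))

    move-left-end : ∀ {i} → LeftEnd i → After bd i → i <ᶠ w₂ → t i ≤ t w₁
    move-left-end {i} ℓ after-i i<w₂ = ≤-transfer (dominates opt _ (alt-∷ after-i i<w₂ (ℓ , right₂) rest))
      (solve 4 (λ x y i v → x :- y :+ v :- (i :- y :+ v) := x :- i) refl (t w₁) (t w₂) (t i) (value W'))

    move-right-end : ∀ {j} → RightEnd j → w₁ <ᶠ j → Alternating (just j) W' → t w₂ ≤ t j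
    move-right-end {j} r w₁<j rest' = ≤-transfer (dominates opt _ (alt-∷ after₁ w₁<j (left₁ , r) rest'))
      (solve 4 (λ x y j v → x :- y :+ v :- (x :- j :+ v) := j :- y) refl (t w₁) (t w₂) (t j) (value W'))

    split-pair : ∀ {i j} → RightEnd j → LeftEnd i → w₁ <ᶠ j → j <ᶠ i → i <ᶠ w₂ → t i ≤ t j
    split-pair {i} {j} r ℓ w₁<j j<i i<w₂ = ≤-transfer
      (dominates opt _ (alt-∷ after₁ w₁<j (left₁ , r) (alt-∷ j<i i<w₂ (ℓ , right₂) rest)))
      (solve 5 (λ x y i j v → x :- y :+ v :- (x :- j :+ (i :- y :+ v)) := j :- i) refl
        (t w₁) (t w₂) (t i) (t j) (value W'))

    tail-optimal : Optimal (just w₂) W'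
    tail-optimal = optimal λ R altR → ≤-transfer (dominates opt _ (alt-∷ after₁ w₁<w₂ (left₁ , right₂) altR))
      (solve 4 (λ x y v r → x :- y :+ v :- (x :- y :+ r) := v :- r) refl (t w₁) (t w₂) (value W') (value R))

  merge-pairs : ∀ {bd w₁ w₂ v₁ v₂ W'} → Optimal bd ((w₁ , w₂) ∷ (v₁ , v₂) ∷ W')
        → Alternating bd ((w₁ , w₂) ∷ (v₁ , v₂) ∷ W') → t w₂ ≤ t v₁
  merge-pairs {w₁ = w₁} {w₂} {v₁} {v₂} {W'} opt alt = ≤-transfer
    (dominates opt _ (alt-∷ after₁ (ℕ.<-trans w₁<w₂ (ℕ.<-trans w₂<v₁ v₁<v₂)) (left₁ , rightᵥ) restᵥ))
    (solve 5 (λ x y u v r → x :- y :+ (u :- v :+ r) :- (x :- v :+ r) := u :- y) refl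
      (t w₁) (t w₂) (t v₁) (t v₂) (value W'))
    where
    open LocalMoves opt alt using (after₁; w₁<w₂; left₁; rest)
    open Head (alt-uncons rest) using () renaming (after to w₂<v₁; ordered to v₁<v₂; right to rightᵥ; rest to restᵥ)

  insert-pair : ∀ {bd W x y} → Optimal bd W → After bd x → x <ᶠ y → Edge (x , y) → Alternating (just y) W
              → t x ≤ t y
  insert-pair {W = W} {x} {y} opt after-x x<y e altW = ≤-transfer (dominates opt _ (alt-∷ after-x x<y e altW))
    (solve 3 (λ w x y → w :- (x :- y :+ w) := y :- x) refl (value W) (t x) (t y))

  interval : Fin n → Fin n → Subset n
  interval p q = tabulate λ i → isYes ((p Fin.<? i) ×-dec (i Fin.<? q))

  ∈-interval⁺ : ∀ {p q i} → p <ᶠ i → i <ᶠ q → i ∈ interval p q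
  ∈-interval⁺ {p} {q} {i} p<i i<q = lookup⇒[]= i _ (trans (lookup∘tabulate _ i)
    (Equivalence.to T-≡ (fromWitness {a? = (p Fin.<? i) ×-dec (i Fin.<? q)} (p<i , i<q))))

  ∈-interval⁻ : ∀ {p q i} → i ∈ interval p q → p <ᶠ i × i <ᶠ q
  ∈-interval⁻ {p} {q} {i} i∈pq = toWitness {a? = (p Fin.<? i) ×-dec (i Fin.<? q)}
    (Equivalence.from T-≡ (trans (sym (lookup∘tabulate _ i)) ([]=⇒lookup i∈pq)))

  ∈-restricted⁻ : ∀ S {p q i} → i ∈ S ∩ interval p q → i ∈ S × p <ᶠ i × i <ᶠ q
  ∈-restricted⁻ S i∈S∩pq = proj₁ (x∈p∩q⁻ S _ i∈S∩pq) , ∈-interval⁻ (proj₂ (x∈p∩q⁻ S _ i∈S∩pq))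

  subArc : (p q : Fin n) → p <ᶠ q → InRange p → InRange q → Arc n
  subArc p q p<q (a≤p , _) (_ , q≤b) = record
    { a = p ; b = q ; a<b = p<q ; A = A ∩ interval p q ; B = B ∩ interval p q
    ; A∪B = λ i → mk⇔ (inside i) (covered i)
    ; A∩B = λ i (i∈A' , i∈B') → A∩B i (proj₁ (∈-restricted⁻ A i∈A') , proj₁ (∈-restricted⁻ B i∈B')) }
    where
    inside : ∀ i → i ∈ A ∩ interval p q ⊎ i ∈ B ∩ interval p q → p <ᶠ i × i <ᶠ q
    inside i (inj₁ i∈A') = proj₂ (∈-restricted⁻ A i∈A')
    inside i (inj₂ i∈B') = proj₂ (∈-restricted⁻ B i∈B')
    covered : ∀ i → p <ᶠ i × i <ᶠ q → i ∈ A ∩ interval p q ⊎ i ∈ B ∩ interval p q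
    covered i (p<i , i<q) with Equivalence.from (A∪B i) (ℕ.≤-<-trans a≤p p<i , ℕ.<-≤-trans i<q q≤b)
    ... | inj₁ i∈A = inj₁ (x∈p∩q⁺ (i∈A , ∈-interval⁺ p<i i<q))
    ... | inj₂ i∈B = inj₂ (x∈p∩q⁺ (i∈B , ∈-interval⁺ p<i i<q))

  subArc-forces : ∀ p q p<q rp rq → Forces (subArc p q p<q rp rq) α
  subArc-forces p q p<q rp rq = proj₁ rp , proj₂ rq , (proj₁ ∘ ∈-restricted⁻ A) , (proj₁ ∘ ∈-restricted⁻ B)

  subArc-shard : ∀ {p q} p<q rp rq → t p ≡ t q
               → (∀ {i} → i ∈ A → p <ᶠ i → i <ᶠ q → t i ≤ t p)
               → (∀ {j} → j ∈ B → p <ᶠ j → j <ᶠ q → t p ≤ t j)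
               → InH F t → InShard F (subArc p q p<q rp rq) t
  subArc-shard p<q rp rq tp≡tq below above t∈H = t∈H , tp≡tq
    , (λ i i∈A' → let i∈A , p<i , i<q = ∈-restricted⁻ A i∈A' in below i∈A p<i i<q)
    , (λ j j∈B' → let j∈B , p<j , j<q = ∈-restricted⁻ B j∈B' in above j∈B p<j j<q)

  record NearShard : Set where
    field
      arc : Arc n
      forces : Forces arc α
      slack : Carrier
      0≤slack : 0# ≤ slack
      tight⇒shard : slack ≡ 0# → InH F t → InShard F arc t

  open NearShard

  descent : ∀ p q (p<q : p <ᶠ q) rp rq → t q ≤ t p
          → (∀ {i} → i ∈ A → p <ᶠ i → i <ᶠ q → t i ≤ t p)
          → (∀ {j} → j ∈ B → p <ᶠ j → j <ᶠ q → t q ≤ t j) → NearShard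
  descent p q p<q rp rq tq≤tp below above = record
    { arc = subArc p q p<q rp rq ; forces = subArc-forces p q p<q rp rq
    ; slack = t p - t q ; 0≤slack = x≤y⇒0≤y-x tq≤tp
    ; tight⇒shard = λ tight → let tp≡tq = x-y≡0⇒x≡y (t p) (t q) tight in
        subArc-shard p<q rp rq tp≡tq below (λ j∈B p<j j<q → subst (_≤ t _) (sym tp≡tq) (above j∈B p<j j<q)) }

  ascent : ∀ p q (p<q : p <ᶠ q) rp rq → t p ≤ t q
         → (∀ {i} → i ∈ A → p <ᶠ i → i <ᶠ q → t i ≤ t q)
         → (∀ {j} → j ∈ B → p <ᶠ j → j <ᶠ q → t p ≤ t j) → NearShard
  ascent p q p<q rp rq tp≤tq below above = record
    { arc = subArc p q p<q rp rq ; forces = subArc-forces p q p<q rp rq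
    ; slack = t q - t p ; 0≤slack = x≤y⇒0≤y-x tp≤tq
    ; tight⇒shard = λ tight → let tq≡tp = x-y≡0⇒x≡y (t q) (t p) tight in
        subArc-shard p<q rp rq (sym tq≡tp) (λ i∈A p<i i<q → subst (t _ ≤_) tq≡tp (below i∈A p<i i<q)) above }

  NearShardBelow : List Pair → List Pair → Set
  NearShardBelow W M = Σ NearShard λ N → slack N ≤ value W - value M

  slack-bound : ∀ {bd W R s} M → Optimal bd W → Alternating bd R → value R ≡ s + value M → s ≤ value W - value M
  slack-bound {W = W} {R} {s} M opt altR R≡s+M = ≤-transfer (dominates opt R altR)
    (trans (cong (λ r → value W - r) R≡s+M) (solve 3 (λ w s m → w :- (s :+ m) := w :- m :- s) refl (value W) s (value M)))

  -- At the first disagreement of W and M, let p be the smaller of the two differing points and q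
  -- the next point of W or M. The sub-arc (p, q) is a near shard whose slack |t p − t q| is at
  -- most value W − value M; the lemmas below are the possible configurations.
  dropped-pair : ∀ {bd w₁ w₂ W' M} → Optimal bd ((w₁ , w₂) ∷ W') → Alternating bd ((w₁ , w₂) ∷ W')
               → Alternating (just w₂) M → NearShardBelow ((w₁ , w₂) ∷ W') M
  dropped-pair {w₁ = w₁} {w₂} {M = M} opt alt altM =
      descent w₁ w₂ w₁<w₂ (left-inRange left₁) (right-inRange right₂) drop-first-pair
        (λ i∈A w₁<i i<w₂ → move-left-end (inj₂ i∈A) (after-< after₁ w₁<i) i<w₂)
        (λ j∈B w₁<j j<w₂ → move-right-end (inj₁ j∈B) w₁<j (alt-after j<w₂ rest))
    , slack-bound M opt (alt-∷ after₁ w₁<w₂ (left₁ , right₂) altM) refl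
    where open LocalMoves opt alt

  missing-pair : ∀ {bd W m₁ m₂ M'} → Optimal bd W → Alternating (just m₂) W → Alternating bd ((m₁ , m₂) ∷ M')
               → NearShardBelow W ((m₁ , m₂) ∷ M')
  missing-pair {m₁ = m₁} {m₂} {M'} opt altW altM =
      ascent m₁ m₂ m₁<m₂ (left-inRange leftₘ) (right-inRange rightₘ)
        (insert-pair opt afterₘ m₁<m₂ (leftₘ , rightₘ) altW)
        (λ i∈A m₁<i i<m₂ → insert-pair opt (after-< afterₘ m₁<i) i<m₂ (inj₂ i∈A , rightₘ) altW)
        (λ j∈B m₁<j j<m₂ → insert-pair opt afterₘ m₁<j (leftₘ , inj₁ j∈B) (alt-after j<m₂ altW))
    , slack-bound ((m₁ , m₂) ∷ M') opt (alt-after (after-< afterₘ m₁<m₂) restₘ)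
        (solve 3 (λ x y v → v := y :- x :+ (x :- y :+ v)) refl (t m₁) (t m₂) (value M'))
    where
    open Head (alt-uncons altM)
      using () renaming (after to afterₘ; ordered to m₁<m₂; left to leftₘ; right to rightₘ; rest to restₘ)

  later-left-end : ∀ {bd w₁ w₂ W' m₁ m₂ M'} → Optimal bd ((w₁ , w₂) ∷ W') → Alternating bd ((w₁ , w₂) ∷ W')
                 → Alternating bd ((m₁ , m₂) ∷ M') → w₁ <ᶠ m₁ → m₁ <ᶠ w₂
                 → NearShardBelow ((w₁ , w₂) ∷ W') ((m₁ , m₂) ∷ M')
  later-left-end {w₁ = w₁} {m₁ = m₁} {m₂} {M'} opt alt altM w₁<m₁ m₁<w₂ =
      descent w₁ m₁ w₁<m₁ (left-inRange left₁) (left-inRange leftₘ)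
        (move-left-end leftₘ (after-< after₁ w₁<m₁) m₁<w₂)
        (λ i∈A w₁<i i<m₁ → move-left-end (inj₂ i∈A) (after-< after₁ w₁<i) (ℕ.<-trans i<m₁ m₁<w₂))
        (λ j∈B w₁<j j<m₁ → split-pair (inj₁ j∈B) leftₘ w₁<j j<m₁ m₁<w₂)
    , slack-bound ((m₁ , m₂) ∷ M') opt (alt-∷ after₁ (ℕ.<-trans w₁<m₁ m₁<m₂) (left₁ , rightₘ) restₘ)
        (solve 4 (λ w m y v → w :- y :+ v := w :- m :+ (m :- y :+ v)) refl (t w₁) (t m₁) (t m₂) (value M'))
    where
    open LocalMoves opt alt
    open Head (alt-uncons altM) using () renaming (ordered to m₁<m₂; left to leftₘ; right to rightₘ; rest to restₘ)

  earlier-left-end : ∀ {bd w₁ w₂ W' m₁ m₂ M'} → Optimal bd ((w₁ , w₂) ∷ W') → Alternating bd ((w₁ , w₂) ∷ W')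
                   → Alternating bd ((m₁ , m₂) ∷ M') → m₁ <ᶠ w₁ → w₁ <ᶠ m₂
                   → NearShardBelow ((w₁ , w₂) ∷ W') ((m₁ , m₂) ∷ M')
  earlier-left-end {w₁ = w₁} {m₁ = m₁} {m₂} {M'} opt alt altM m₁<w₁ w₁<m₂ =
      ascent m₁ w₁ m₁<w₁ (left-inRange leftₘ) (left-inRange left₁)
        (move-left-end leftₘ afterₘ (ℕ.<-trans m₁<w₁ w₁<w₂))
        (λ i∈A m₁<i i<w₁ → move-left-end (inj₂ i∈A) (after-< afterₘ m₁<i) (ℕ.<-trans i<w₁ w₁<w₂))
        (λ j∈B m₁<j j<w₁ → insert-pair opt afterₘ m₁<j (leftₘ , inj₁ j∈B) (alt-rebase j<w₁ alt))
    , slack-bound ((m₁ , m₂) ∷ M') opt (alt-∷ after₁ w₁<m₂ (left₁ , rightₘ) restₘ)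
        (solve 4 (λ w m y v → w :- y :+ v := w :- m :+ (m :- y :+ v)) refl (t w₁) (t m₁) (t m₂) (value M'))
    where
    open LocalMoves opt alt
    open Head (alt-uncons altM) using () renaming (after to afterₘ; left to leftₘ; right to rightₘ; rest to restₘ)

  later-right-end : ∀ {bd x w₂ W' m₂ M'} → Optimal bd ((x , w₂) ∷ W') → Alternating bd ((x , w₂) ∷ W')
                  → Alternating bd ((x , m₂) ∷ M') → w₂ <ᶠ m₂ → Alternating (just m₂) W'
                  → NearShardBelow ((x , w₂) ∷ W') ((x , m₂) ∷ M')
  later-right-end {x = x} {w₂} {m₂ = m₂} {M'} opt alt altM w₂<m₂ altW' =
      ascent w₂ m₂ w₂<m₂ (right-inRange right₂) (right-inRange rightₘ) (move-right-end rightₘ x<m₂ altW')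
        (λ i∈A w₂<i i<m₂ → insert-pair tail-optimal w₂<i i<m₂ (inj₂ i∈A , rightₘ) altW')
        (λ j∈B w₂<j j<m₂ → move-right-end (inj₁ j∈B) (ℕ.<-trans w₁<w₂ w₂<j) (alt-after j<m₂ altW'))
    , slack-bound ((x , m₂) ∷ M') opt (alt-∷ after₁ w₁<w₂ (left₁ , right₂) (alt-after w₂<m₂ restₘ))
        (solve 4 (λ x w m v → x :- w :+ v := m :- w :+ (x :- m :+ v)) refl (t x) (t w₂) (t m₂) (value M'))
    where
    open LocalMoves opt alt
    open Head (alt-uncons altM) using () renaming (ordered to x<m₂; right to rightₘ; rest to restₘ)

  later-right-end-past-pair : ∀ {bd x w₂ v₁ v₂ W' m₂ M'} → Optimal bd ((x , w₂) ∷ (v₁ , v₂) ∷ W')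
                            → Alternating bd ((x , w₂) ∷ (v₁ , v₂) ∷ W') → Alternating bd ((x , m₂) ∷ M')
                            → v₁ <ᶠ m₂ → NearShardBelow ((x , w₂) ∷ (v₁ , v₂) ∷ W') ((x , m₂) ∷ M')
  later-right-end-past-pair {x = x} {w₂} {v₁} {m₂ = m₂} {M'} opt alt altM v₁<m₂ =
      ascent w₂ v₁ w₂<v₁ (right-inRange right₂) (left-inRange leftᵥ) (merge-pairs opt alt)
        (λ i∈A w₂<i i<v₁ → LocalMoves.move-left-end tail-optimal rest (inj₂ i∈A) w₂<i (ℕ.<-trans i<v₁ v₁<v₂))
        (λ j∈B w₂<j j<v₁ → move-right-end (inj₁ j∈B) (ℕ.<-trans w₁<w₂ w₂<j) (alt-rebase j<v₁ rest))
    , slack-bound ((x , m₂) ∷ M') opt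
        (alt-∷ after₁ w₁<w₂ (left₁ , right₂) (alt-∷ w₂<v₁ v₁<m₂ (leftᵥ , rightₘ) restₘ))
        (solve 5 (λ x w v m r → x :- w :+ (v :- m :+ r) := v :- w :+ (x :- m :+ r)) refl
          (t x) (t w₂) (t v₁) (t m₂) (value M'))
    where
    open LocalMoves opt alt
    open Head (alt-uncons rest) using () renaming (after to w₂<v₁; ordered to v₁<v₂; left to leftᵥ)
    open Head (alt-uncons altM) using () renaming (right to rightₘ; rest to restₘ)

  earlier-right-end : ∀ {bd x w₂ W' m₂ M'} → Optimal bd ((x , w₂) ∷ W') → Alternating bd ((x , w₂) ∷ W')
                    → Alternating bd ((x , m₂) ∷ M') → m₂ <ᶠ w₂ → Alternating (just w₂) M'
                    → NearShardBelow ((x , w₂) ∷ W') ((x , m₂) ∷ M')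
  earlier-right-end {x = x} {w₂} {m₂ = m₂} {M'} opt alt altM m₂<w₂ altM' =
      descent m₂ w₂ m₂<w₂ (right-inRange rightₘ) (right-inRange right₂)
        (move-right-end rightₘ x<m₂ (alt-after m₂<w₂ rest))
        (λ i∈A m₂<i i<w₂ → split-pair rightₘ (inj₂ i∈A) x<m₂ m₂<i i<w₂)
        (λ j∈B m₂<j j<w₂ → move-right-end (inj₁ j∈B) (ℕ.<-trans x<m₂ m₂<j) (alt-after j<w₂ rest))
    , slack-bound ((x , m₂) ∷ M') opt (alt-∷ after₁ w₁<w₂ (left₁ , right₂) altM')
        (solve 4 (λ x w m v → x :- w :+ v := m :- w :+ (x :- m :+ v)) refl (t x) (t w₂) (t m₂) (value M'))
    where
    open LocalMoves opt alt
    open Head (alt-uncons altM) using () renaming (ordered to x<m₂; right to rightₘ)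

  earlier-right-end-past-pair : ∀ {bd x w₂ W' m₂ u₁ u₂ M'} → Optimal bd ((x , w₂) ∷ W')
                              → Alternating bd ((x , w₂) ∷ W') → Alternating bd ((x , m₂) ∷ (u₁ , u₂) ∷ M')
                              → u₁ <ᶠ w₂ → NearShardBelow ((x , w₂) ∷ W') ((x , m₂) ∷ (u₁ , u₂) ∷ M')
  earlier-right-end-past-pair {x = x} {m₂ = m₂} {u₁} {u₂} {M'} opt alt altM u₁<w₂ =
      descent m₂ u₁ m₂<u₁ (right-inRange rightₘ) (left-inRange leftᵤ)
        (split-pair rightₘ leftᵤ x<m₂ m₂<u₁ u₁<w₂)
        (λ i∈A m₂<i i<u₁ → split-pair rightₘ (inj₂ i∈A) x<m₂ m₂<i (ℕ.<-trans i<u₁ u₁<w₂))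
        (λ j∈B m₂<j j<u₁ → split-pair (inj₁ j∈B) leftᵤ (ℕ.<-trans x<m₂ m₂<j) j<u₁ u₁<w₂)
    , slack-bound ((x , m₂) ∷ (u₁ , u₂) ∷ M') opt
        (alt-∷ after₁ (ℕ.<-trans x<m₂ (ℕ.<-trans m₂<u₁ u₁<u₂)) (left₁ , rightᵤ) restᵤ)
        (solve 5 (λ x m u v r → x :- v :+ r := m :- u :+ (x :- m :+ (u :- v :+ r))) refl
          (t x) (t m₂) (t u₁) (t u₂) (value M'))
    where
    open LocalMoves opt alt
    open Head (alt-uncons altM) using () renaming (ordered to x<m₂; right to rightₘ; rest to restₘ)
    open Head (alt-uncons restₘ) using ()
      renaming (after to m₂<u₁; ordered to u₁<u₂; left to leftᵤ; right to rightᵤ; rest to restᵤ)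

  common-head : ∀ {x y W' M'} → NearShardBelow W' M' → NearShardBelow ((x , y) ∷ W') ((x , y) ∷ M')
  common-head {x} {y} {W'} {M'} (N , bound) = N , subst (slack N ≤_)
    (solve 4 (λ x y w m → w :- m := x :- y :+ w :- (x :- y :+ m)) refl (t x) (t y) (value W') (value M')) bound

  later-right-end-cases : ∀ {bd x w₂ m₂ M'} W' → Optimal bd ((x , w₂) ∷ W') → Alternating bd ((x , w₂) ∷ W')
                        → Alternating bd ((x , m₂) ∷ M') → w₂ <ᶠ m₂
                        → NearShardBelow ((x , w₂) ∷ W') ((x , m₂) ∷ M')
  later-right-end-cases [] opt alt altM w₂<m₂ = later-right-end opt alt altM w₂<m₂ (alternating tt [])
  later-right-end-cases {m₂ = m₂} ((v₁ , v₂) ∷ W') opt alt altM w₂<m₂ with Fin.<-cmp m₂ v₁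
  ... | tri< m₂<v₁ _ _ = later-right-end opt alt altM w₂<m₂ (alt-rebase m₂<v₁ (Head.rest (alt-uncons alt)))
  ... | tri≈ _ m₂≡v₁ _ = ⊥-elim (left≢right (Head.left (alt-uncons (Head.rest (alt-uncons alt))))
                                            (Head.right (alt-uncons altM)) (sym m₂≡v₁))
  ... | tri> _ _ v₁<m₂ = later-right-end-past-pair opt alt altM v₁<m₂

  earlier-right-end-cases : ∀ {bd x w₂ W' m₂} M' → Optimal bd ((x , w₂) ∷ W') → Alternating bd ((x , w₂) ∷ W')
                          → Alternating bd ((x , m₂) ∷ M') → m₂ <ᶠ w₂
                          → NearShardBelow ((x , w₂) ∷ W') ((x , m₂) ∷ M')
  earlier-right-end-cases [] opt alt altM m₂<w₂ = earlier-right-end opt alt altM m₂<w₂ (alternating tt [])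
  earlier-right-end-cases {w₂ = w₂} ((u₁ , u₂) ∷ M') opt alt altM m₂<w₂ with Fin.<-cmp w₂ u₁
  ... | tri< w₂<u₁ _ _ = earlier-right-end opt alt altM m₂<w₂ (alt-rebase w₂<u₁ (Head.rest (alt-uncons altM)))
  ... | tri≈ _ w₂≡u₁ _ = ⊥-elim (left≢right (Head.left (alt-uncons (Head.rest (alt-uncons altM))))
                                            (Head.right (alt-uncons alt)) (sym w₂≡u₁))
  ... | tri> _ _ u₁<w₂ = earlier-right-end-past-pair opt alt altM u₁<w₂

  first-difference : ∀ {bd} W M → Optimal bd W → Alternating bd W → Alternating bd M → ¬ W ≡ M
                   → NearShardBelow W M
  first-difference [] [] _ _ _ W≢M = ⊥-elim (W≢M refl)
  first-difference [] ((_ , _) ∷ _) opt _ altM _ = missing-pair opt (alternating tt []) altM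
  first-difference ((_ , _) ∷ _) [] opt altW _ _ = dropped-pair opt altW (alternating tt [])
  first-difference ((w₁ , w₂) ∷ W') ((m₁ , m₂) ∷ M') opt altW altM W≢M with Fin.<-cmp w₁ m₁
  ... | tri< w₁<m₁ _ _ with Fin.<-cmp w₂ m₁
  ...   | tri< w₂<m₁ _ _ = dropped-pair opt altW (alt-rebase w₂<m₁ altM)
  ...   | tri≈ _ w₂≡m₁ _ =
    ⊥-elim (left≢right (Head.left (alt-uncons altM)) (Head.right (alt-uncons altW)) (sym w₂≡m₁))
  ...   | tri> _ _ m₁<w₂ = later-left-end opt altW altM w₁<m₁ m₁<w₂
  first-difference ((w₁ , w₂) ∷ W') ((m₁ , m₂) ∷ M') opt altW altM W≢M | tri> _ _ m₁<w₁ with Fin.<-cmp m₂ w₁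
  ...   | tri< m₂<w₁ _ _ = missing-pair opt (alt-rebase m₂<w₁ altW) altM
  ...   | tri≈ _ m₂≡w₁ _ =
    ⊥-elim (left≢right (Head.left (alt-uncons altW)) (Head.right (alt-uncons altM)) (sym m₂≡w₁))
  ...   | tri> _ _ w₁<m₂ = earlier-left-end opt altW altM m₁<w₁ w₁<m₂
  first-difference ((w₁ , w₂) ∷ W') ((.w₁ , m₂) ∷ M') opt altW altM W≢M | tri≈ _ refl _ with Fin.<-cmp w₂ m₂
  ...   | tri< w₂<m₂ _ _ = later-right-end-cases W' opt altW altM w₂<m₂
  ...   | tri> _ _ m₂<w₂ = earlier-right-end-cases M' opt altW altM m₂<w₂
  ...   | tri≈ _ refl _ = common-head {w₁} {w₂} {W'} {M'} (first-difference W' M' (LocalMoves.tail-optimal opt altW)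
      (Head.rest (alt-uncons altW)) (Head.rest (alt-uncons altM)) (W≢M ∘ cong ((w₁ , w₂) ∷_)))

  Term : Set
  Term = List Pair × Carrier

  Admissible : Term → Set
  Admissible (M , l) = Alternating nothing M × 0# ≤ l

  totalWeight : List Term → Carrier
  totalWeight [] = 0#
  totalWeight ((_ , l) ∷ L) = l + totalWeight L

  meanValue : List Term → Carrier
  meanValue [] = 0#
  meanValue ((M , l) ∷ L) = l * value M + meanValue L

  inner-combo : ∀ L → inner F t (combo F L) ≡ meanValue L
  inner-combo [] = inner-0 t
  inner-combo ((M , l) ∷ L) = trans (inner-+ t (λ j → l * χ F M j) (combo F L))
    (cong₂ _+_ (trans (inner-* t (χ F M) l) (cong (l *_) (inner-χ M))) (inner-combo L))

  χ∈SP : ∀ {M} → Alternating nothing M → InSP F α (χ F M)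
  χ∈SP {M} (alternating c es) = (M , 1#) ∷ [] , ((c , All.map (λ { {_ , _} e → e }) es) , 0≤1) ∷ []
    , +-identityʳ 1# , λ j → sym (trans (+-identityʳ _) (*-identityˡ _))

  record Representation (z : Vect F n) : Set where
    field
      terms : List Term
      admissible : All Admissible terms
      totalWeight≡1 : totalWeight terms ≡ 1#
      z≡combo : ∀ j → z j ≡ combo F terms j

  open Representation

  -- InSP sums the weights with a function local to its definition, which
  -- from-Σ abstracts and identifies with totalWeight by its defining equations.
  representation : ∀ {z} → InSP F α z → Representation z
  representation = from-Σ (λ adm → adm) refl (λ _ _ _ → refl)
    where
    from-Σ : ∀ {z} {Q : Term → Set} {w : List Term → Carrier}
           → (∀ {M l} → Q (M , l) → IsAltMatching α M × 0# ≤ l)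
           → w [] ≡ 0# → (∀ M l L → w ((M , l) ∷ L) ≡ l + w L)
           → Σ (List Term) (λ L → All Q L × w L ≡ 1# × (∀ j → z j ≡ combo F L j)) → Representation z
    from-Σ {w = w} to-adm w[] w∷ (L , adm , w≡1 , z≡) = record
      { terms = L
      ; admissible = All.map (λ { {M , l} q → let (c , es) , 0≤l = to-adm q in
                                    alternating c (All.map (λ { {_ , _} e → e }) es) , 0≤l }) adm
      ; totalWeight≡1 = trans (sym (w≡totalWeight L)) w≡1
      ; z≡combo = z≡ }
      where
      w≡totalWeight : ∀ L → w L ≡ totalWeight L
      w≡totalWeight [] = w[]
      w≡totalWeight ((M , l) ∷ L) = trans (w∷ M l L) (cong (l +_) (w≡totalWeight L))

  inner-representation : ∀ {z} (R : Representation z) → inner F t z ≡ meanValue (terms R)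
  inner-representation R = trans (inner-cong t (z≡combo R)) (inner-combo (terms R))

  meanValue≤0 : (∀ M → Alternating nothing M → value M ≤ 0#) → ∀ L → All Admissible L → meanValue L ≤ 0#
  meanValue≤0 value≤0 [] [] = ≤-refl
  meanValue≤0 value≤0 ((M , l) ∷ L) ((altM , 0≤l) ∷ adm) = subst (meanValue ((M , l) ∷ L) ≤_) (+-identityʳ 0#)
    (+-mono-≤ (subst₂ _≤_ (*-comm (value M) l) (zeroˡ l) (*-monoˡ-≤-nonNeg l 0≤l (value≤0 M altM)))
              (meanValue≤0 value≤0 L adm))

  shard⊆walls : InShard F α t → InWalls F α t
  shard⊆walls (t∈H , ta≡tb , A-below , B-above) =
      t∈H , χ F [] , χ F ((a , b) ∷ []) , maximizer (alternating tt []) refl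
    , maximizer (alternating (a<b , tt) ((inj₁ refl , inj₂ refl) ∷ [])) (trans (+-identityʳ _) (x≡y⇒x-y≡0 ta≡tb))
    , χ[]≢χab
    where
    open ≡-Reasoning
    edge-≤ : ∀ {x y} → Edge (x , y) → t x ≤ t y
    edge-≤ (ℓ , r) = ≤-trans (below ℓ) (above r)
      where
      below : ∀ {x} → LeftEnd x → t x ≤ t a
      below (inj₁ refl) = ≤-refl
      below (inj₂ x∈A) = A-below _ x∈A
      above : ∀ {y} → RightEnd y → t a ≤ t y
      above (inj₁ y∈B) = B-above _ y∈B
      above (inj₂ refl) = ≤-reflexive ta≡tb
    value≤0 : ∀ M → All Edge M → value M ≤ 0#
    value≤0 [] [] = ≤-refl
    value≤0 ((x , y) ∷ M) (e ∷ es) =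
      subst (value ((x , y) ∷ M) ≤_) (+-identityʳ 0#) (+-mono-≤ (x≤y⇒x-y≤0 (edge-≤ e)) (value≤0 M es))
    maximizer : ∀ {M} → Alternating nothing M → value M ≡ 0# → IsMaximizer F α t (χ F M)
    maximizer {M} altM value≡0 = χ∈SP altM , λ y y∈SP → let R = representation y∈SP in
      subst₂ _≤_ (sym (inner-representation R)) (sym (trans (inner-χ M) value≡0))
        (meanValue≤0 (λ M' altM' → value≤0 M' (Alternating.edges altM')) (terms R) (admissible R))
    χ[]≢χab : ¬ (∀ j → χ F [] j ≡ χ F ((a , b) ∷ []) j)
    χ[]≢χab χ[]≡χab = 0≢1 (trans (χ[]≡χab a) (begin
      basis F a a - basis F b a + 0# ≡⟨ cong₂ (λ u v → u - v + 0#) (basis-≡ {i = a} refl)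
                                              (basis-≢ {i = b} {a} λ b≡a → Fin.<-irrefl (sym b≡a) a<b) ⟩
      1# - 0# + 0#                   ≡⟨ solve 1 (λ o → o :- :0 :+ :0 := o) refl 1# ⟩
      1#                             ∎))

  loss : Term → Carrier
  loss (M , l) = l * (value best - value M)

  totalLoss : List Term → Carrier
  totalLoss [] = 0#
  totalLoss (e ∷ L) = loss e + totalLoss L

  totalLoss≡ : ∀ L → totalLoss L ≡ totalWeight L * value best - meanValue L
  totalLoss≡ [] = solve 1 (λ v → :0 := :0 :* v :- :0) refl (value best)
  totalLoss≡ ((M , l) ∷ L) = trans (cong (loss (M , l) +_) (totalLoss≡ L))
    (solve 5 (λ l v m w s → l :* (v :- m) :+ (w :* v :- s) := (l :+ w) :* v :- (l :* m :+ s)) refl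
      l (value best) (value M) (totalWeight L) (meanValue L))

  0≤loss : ∀ {e} → Admissible e → 0# ≤ loss e
  0≤loss {M , l} (altM , 0≤l) = *-nonneg 0≤l (x≤y⇒0≤y-x (dominates best-optimal M altM))

  0≤totalLoss : ∀ L → All Admissible L → 0# ≤ totalLoss L
  0≤totalLoss [] [] = ≤-refl
  0≤totalLoss (e ∷ L) (adm ∷ adms) =
    subst (_≤ totalLoss (e ∷ L)) (+-identityˡ 0#) (+-mono-≤ (0≤loss adm) (0≤totalLoss L adms))

  totalLoss≤0⇒loss≡0 : ∀ L → All Admissible L → totalLoss L ≤ 0# → All (λ e → loss e ≡ 0#) L
  totalLoss≤0⇒loss≡0 [] [] _ = []
  totalLoss≤0⇒loss≡0 (e ∷ L) (adm ∷ adms) ≤0 =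
      x+y≤0⇒x≡0 (0≤loss adm) (0≤totalLoss L adms) ≤0
    ∷ totalLoss≤0⇒loss≡0 L adms (≤-reflexive (x+y≤0⇒y≡0 (0≤loss adm) (0≤totalLoss L adms) ≤0))

  Maximal : Vect F n → Set
  Maximal z = ∀ y → InSP F α y → inner F t y ≤ inner F t z

  maximizer-lossless : ∀ {z} → Maximal z → (R : Representation z) → All (λ e → loss e ≡ 0#) (terms R)
  maximizer-lossless {z} z-max R = totalLoss≤0⇒loss≡0 (terms R) (admissible R)
    (≤-transfer (z-max _ (χ∈SP best-alternating)) (begin
      inner F t z - inner F t (χ F best)              ≡⟨ cong₂ _-_ (inner-representation R) (inner-χ best) ⟩
      meanValue L - value best                        ≡⟨ solve 2 (λ m v → m :- v := :0 :- (v :- m)) refl _ _ ⟩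
      0# - (value best - meanValue L)                 ≡⟨ cong (λ w → 0# - (w - meanValue L)) (*-identityˡ (value best)) ⟨
      0# - (1# * value best - meanValue L)
        ≡⟨ cong (λ w → 0# - (w * value best - meanValue L)) (totalWeight≡1 R) ⟨
      0# - (totalWeight L * value best - meanValue L) ≡⟨ cong (λ u → 0# - u) (totalLoss≡ L) ⟨
      0# - totalLoss L                                ∎))
    where
    open ≡-Reasoning
    L : List Term
    L = terms R

  WithinSlack : Carrier → Term → Set
  WithinSlack c (M , _) = M ≡ best ⊎ c ≤ value best - value M

  deviation-killed : ∀ {c} → 0# ≤ c → ∀ L → All Admissible L → All (λ e → loss e ≡ 0#) L → All (WithinSlack c) L
                   → ∀ j → c * (combo F L j - totalWeight L * χ F best j) ≡ 0#
  deviation-killed {c} 0≤c [] [] [] [] j =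
    solve 2 (λ c w → c :* (:0 :- :0 :* w) := :0) refl c (χ F best j)
  deviation-killed {c} 0≤c ((M , l) ∷ L) ((_ , 0≤l) ∷ adms) (lossless ∷ losslesses) (within ∷ withins) j = begin
    c * (l * χ F M j + combo F L j - (l + totalWeight L) * w)
      ≡⟨ solve 6 (λ c l m s v w → c :* (l :* m :+ s :- (l :+ v) :* w) := l :* c :* (m :- w) :+ c :* (s :- v :* w)) refl
           c l (χ F M j) (combo F L j) (totalWeight L) w ⟩
    l * c * (χ F M j - w) + c * (combo F L j - totalWeight L * w)
      ≡⟨ cong₂ _+_ (head-killed within) (deviation-killed 0≤c L adms losslesses withins j) ⟩
    0# + 0# ≡⟨ +-identityʳ 0# ⟩
    0#      ∎
    where
    open ≡-Reasoning
    w : Carrier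
    w = χ F best j
    head-killed : WithinSlack c (M , l) → l * c * (χ F M j - w) ≡ 0#
    head-killed (inj₁ refl) = trans (cong (l * c *_) (-‿inverseʳ w)) (zeroʳ _)
    head-killed (inj₂ c≤gap) = trans (cong (_* (χ F M j - w)) (*≡0-antimono 0≤l 0≤c c≤gap lossless)) (zeroˡ _)

  maximizer-deviation : ∀ {c z} → 0# ≤ c → Maximal z → (R : Representation z) → All (WithinSlack c) (terms R)
                      → ∀ j → c * (z j - χ F best j) ≡ 0#
  maximizer-deviation {c} {z} 0≤c z-max R within j = begin
    c * (z j - χ F best j)                          ≡⟨ cong (λ u → c * (u - χ F best j)) (z≡combo R j) ⟩
    c * (combo F L j - χ F best j)                  ≡⟨ cong (λ u → c * (combo F L j - u)) (*-identityˡ _) ⟨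
    c * (combo F L j - 1# * χ F best j)
      ≡⟨ cong (λ u → c * (combo F L j - u * χ F best j)) (totalWeight≡1 R) ⟨
    c * (combo F L j - totalWeight L * χ F best j)
      ≡⟨ deviation-killed 0≤c L (admissible R) (maximizer-lossless z-max R) within j ⟩
    0#                                              ∎
    where
    open ≡-Reasoning
    L : List Term
    L = terms R

  record SlackBound (L : List Term) : Set where
    field
      bound : Carrier
      0≤bound : 0# ≤ bound
      within : All (WithinSlack bound) L
      tight⇒forced-shard : bound ≡ 0# → InH F t → ∃[ α' ] (Forces α' α × InShard F α' t)

  open SlackBound

  -- 1# serves as the bound when every matching is best: it can never be tight.
  slackBound[] : SlackBound []
  slackBound[] = record
    { bound = 1# ; 0≤bound = 0≤1 ; within = [] ; tight⇒forced-shard = λ 1≡0 _ → ⊥-elim (0≢1 (sym 1≡0)) }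

  slackBound-∷-best : ∀ {M l L} → M ≡ best → SlackBound L → SlackBound ((M , l) ∷ L)
  slackBound-∷-best M≡best S = record
    { bound = bound S ; 0≤bound = 0≤bound S ; within = inj₁ M≡best ∷ within S
    ; tight⇒forced-shard = tight⇒forced-shard S }

  slackBound-∷-nearShard : ∀ {M l L} → NearShardBelow best M → SlackBound L → SlackBound ((M , l) ∷ L)
  slackBound-∷-nearShard (N , N≤gap) S with total (slack N) (bound S)
  ... | inj₁ N≤S = record
    { bound = slack N ; 0≤bound = 0≤slack N
    ; within = inj₂ N≤gap ∷ All.map (λ { {_ , _} → Sum.map₂ (≤-trans N≤S) }) (within S)
    ; tight⇒forced-shard = λ tight t∈H → arc N , forces N , tight⇒shard N tight t∈H }
  ... | inj₂ S≤N = record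
    { bound = bound S ; 0≤bound = 0≤bound S ; within = inj₂ (≤-trans S≤N N≤gap) ∷ within S
    ; tight⇒forced-shard = tight⇒forced-shard S }

  slackBound : ∀ L → All Admissible L → SlackBound L
  slackBound [] [] = slackBound[]
  slackBound ((M , l) ∷ L) ((altM , _) ∷ adms) with List.≡-dec (Product.≡-dec Fin._≟_ Fin._≟_) M best
  ... | yes M≡best = slackBound-∷-best M≡best (slackBound L adms)
  ... | no M≢best = slackBound-∷-nearShard
    (first-difference best M best-optimal best-alternating altM (M≢best ∘ sym)) (slackBound L adms)

  walls⊆forced-shards : InWalls F α t → ∃[ α' ] (Forces α' α × InShard F α' t)
  walls⊆forced-shards (t∈H , x , y , (x∈SP , x-max) , (y∈SP , y-max) , x≢y) =
    tight⇒forced-shard S (c*v≡0⇒c≡0 (λ j → x j - y j) x-y≢0 (bound S) bound*[x-y]≡0) t∈H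
    where
    open ≡-Reasoning
    Rx : Representation x
    Rx = representation x∈SP
    Ry : Representation y
    Ry = representation y∈SP
    S : SlackBound (terms Rx ++ terms Ry)
    S = slackBound (terms Rx ++ terms Ry) (All.++⁺ (admissible Rx) (admissible Ry))
    x-y≢0 : ¬ (∀ j → x j - y j ≡ 0#)
    x-y≢0 x-y≡0 = x≢y (λ j → x-y≡0⇒x≡y (x j) (y j) (x-y≡0 j))
    bound*[x-y]≡0 : ∀ j → bound S * (x j - y j) ≡ 0#
    bound*[x-y]≡0 j = begin
      bound S * (x j - y j)
        ≡⟨ solve 4 (λ c x y w → c :* (x :- y) := c :* (x :- w) :- c :* (y :- w)) refl (bound S) (x j) (y j) (χ F best j) ⟩
      bound S * (x j - χ F best j) - bound S * (y j - χ F best j)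
        ≡⟨ cong₂ _-_ (maximizer-deviation (0≤bound S) x-max Rx (All.++⁻ˡ (terms Rx) (within S)) j)
                     (maximizer-deviation (0≤bound S) y-max Ry (All.++⁻ʳ (terms Rx) (within S)) j) ⟩
      0# - 0#
        ≡⟨ -‿inverseʳ 0# ⟩
      0# ∎

proposition48 : (F : OrderedField) (n : ℕ) (α : Arc n) →
    (∀ t → InShard F α t → InWalls F α t)
    × (∀ t → InWalls F α t → ∃[ α' ] (Forces α' α × InShard F α' t))
proposition48 F n α = (λ t → Matchings.shard⊆walls F α t) , (λ t → Matchings.walls⊆forced-shards F α t)
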